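{- Let $\delta,K_1,K_2,C_0,C_1$ be admissible parameters and $M$ a magic distance. Let $a,b\in\{1,\dots,\delta\}\setminus\{M\}$ and suppose there exists $c\in\{1,\dots,\delta\}$ with $(b,c)\in\mathbb{F}_M(a)$. Then $t_M(a)>t_M(b)$.
   Context: Parameters $\delta,K_1,K_2,C_0,C_1$ are positive integers; acceptable if $3\le\delta<\infty$, $1\le K_1\le K_2\le\delta$, $2\delta+2\le C_0,C_1\le 3\delta+2$, $C_0$ even, $C_1$ odd. $C=\min(C_0,C_1)$, $C'=\max(C_0,C_1)$. Admissible: acceptable and either (II) $C\le 2\delta+K_1$, $C=2K_1+2K_2+1$, $K_1+K_2\ge\delta$, $K_1+2K_2\le 2\delta-1$, and either (IIA) $C'=C+1$ or (IIB) $C'>C+1$, $K_1=K_2$, $3K_2=2\delta-1$; or (III) $C\ge 2\delta+K_1+1$, $K_1+2K_2\ge 2\delta-1$, $3K_2\ge 2\delta$, if $K_1+2K_2=2\delta-1$ then $C\ge 2\delta+K_1+2$, and if $C'>C+1$ then $C\ge 2\delta+K_2$. A distance $M\in\{1,\dots,\delta\}$ is magic if $\max(K_1,\lceil\delta/2\rceil)\le M\le\min(K_2,\lfloor(C-\delta-1)/2\rfloor)$. For $x\in\{1,\dots,\delta\}\setminus\{M\}$ let $\mathcal{F}^+_x=\{(a,b)\in\{1,\dots,\delta\}^2:a+b=x\}$, $\mathcal{F}^-_x=\{(a,b):|a-b|=x\}$, $\mathcal{F}^C_x=\{(a,b):C-1-a-b=x\}$; set $\mathbb{F}_M(x)=\mathcal{F}^+_x\cup\mathcal{F}^C_x$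 if $x<M$ and $\mathbb{F}_M(x)=\mathcal{F}^-_x$ if $x>M$; and $t_M(x)=2x-1$ if $x<M$, $t_M(x)=2(\delta-x)$ if $x>M$. -}

module Defs where

open import Data.Nat using (ℕ; _+_; _*_; _∸_; _≤_; _<_; _≡ᵇ_; ⌊_/2⌋; ⌈_/2⌉; ∣_-_∣; _⊔_; _⊓_)
open import Data.Nat using (_<ᵇ_)
open import Data.Bool using (if_then_else_)
open import Data.Nat.Divisibility using (_∣_)
open import Data.Product using (_×_; Σ)
open import Data.Sum using (_⊎_)
open import Relation.Binary.PropositionalEquality using (_≡_; _≢_)
open import Relation.Nullary using (¬_)

Even : ℕ → Set
Even n = 2 ∣ n

Odd : ℕ → Set
Odd n = ¬ (2 ∣ n)

-- acceptable parameters (δ finite is automatic for ℕ)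
Acceptable : ℕ → ℕ → ℕ → ℕ → ℕ → Set
Acceptable δ K₁ K₂ C₀ C₁ =
  (3 ≤ δ) × (1 ≤ K₁) × (K₁ ≤ K₂) × (K₂ ≤ δ) ×
  (2 * δ + 2 ≤ C₀) × (C₀ ≤ 3 * δ + 2) ×
  (2 * δ + 2 ≤ C₁) × (C₁ ≤ 3 * δ + 2) ×
  Even C₀ × Odd C₁

CaseII : ℕ → ℕ → ℕ → ℕ → ℕ → Set
CaseII δ K₁ K₂ C C' =
  (C ≤ 2 * δ + K₁) × (C ≡ 2 * K₁ + 2 * K₂ + 1) × (δ ≤ K₁ + K₂) ×
  (K₁ + 2 * K₂ ≤ 2 * δ ∸ 1) ×
  ((C' ≡ C + 1) ⊎ ((C + 1 < C') × (K₁ ≡ K₂) × (3 * K₂ ≡ 2 * δ ∸ 1)))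

CaseIII : ℕ → ℕ → ℕ → ℕ → ℕ → Set
CaseIII δ K₁ K₂ C C' =
  (2 * δ + K₁ + 1 ≤ C) × (2 * δ ∸ 1 ≤ K₁ + 2 * K₂) × (2 * δ ≤ 3 * K₂) ×
  (K₁ + 2 * K₂ ≡ 2 * δ ∸ 1 → 2 * δ + K₁ + 2 ≤ C) ×
  (C + 1 < C' → 2 * δ + K₂ ≤ C)

Admissible : ℕ → ℕ → ℕ → ℕ → ℕ → Set
Admissible δ K₁ K₂ C₀ C₁ =
  Acceptable δ K₁ K₂ C₀ C₁ ×
  (CaseII δ K₁ K₂ (C₀ ⊓ C₁) (C₀ ⊔ C₁) ⊎ CaseIII δ K₁ K₂ (C₀ ⊓ C₁) (C₀ ⊔ C₁))

Magic : ℕ → ℕ → ℕ → ℕ → ℕ → Set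
Magic δ K₁ K₂ C M =
  (1 ≤ M) × (M ≤ δ) ×
  (K₁ ⊔ ⌈ δ /2⌉ ≤ M) × (M ≤ K₂ ⊓ ⌊ (C ∸ δ ∸ 1) /2⌋)

InRange : ℕ → ℕ → Set
InRange δ x = (1 ≤ x) × (x ≤ δ)

-- the families (pairs are assumed in {1..δ}² separately)
F⁺ : ℕ → ℕ → ℕ → Set
F⁺ x a b = a + b ≡ x

F⁻ : ℕ → ℕ → ℕ → Set
F⁻ x a b = ∣ a - b ∣ ≡ x

-- C - 1 - a - b = x, written over ℕ without truncation
Fᶜ : ℕ → ℕ → ℕ → ℕ → Set
Fᶜ C x a b = a + b + x + 1 ≡ C

𝔽 : ℕ → ℕ → ℕ → ℕ → ℕ → ℕ → Set
𝔽 δ C M x a b =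
  InRange δ a × InRange δ b ×
  (((x < M) × (F⁺ x a b ⊎ Fᶜ C x a b)) ⊎ ((M < x) × F⁻ x a b))

t : ℕ → ℕ → ℕ → ℕ
t δ M x = if x <ᵇ M then 2 * x ∸ 1 else 2 * (δ ∸ x)

-- Write S = C − δ − 1. A magic M satisfies δ ≤ 2M ≤ S, and acceptability gives δ < S.
-- On the sum family b < a < M, so t increases. On the complementary family a + b ≥ S ≥ 2M,
-- so b > M and a + b > δ, which puts t(b) = 2(δ − b) below t(a) = 2a − 1. On the difference
-- family either b = c + a, so M < a < b and t decreases, or c = b + a ≤ δ ≤ 2M forces b < M
-- and b + a ≤ δ, which puts t(b) = 2b − 1 below t(a) = 2(δ − a).
module Submission where

open import Data.Bool using (T; true; false)
open import Data.List.Base using ([]; _∷_)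
open import Data.Nat
open import Data.Nat.Properties
open import Data.Nat.Tactic.RingSolver using (solve)
open import Data.Product using (Σ; _×_; _,_)
open import Data.Sum using (_⊎_; inj₁; inj₂)
import Data.Sum as Sum
open import Relation.Binary.Definitions using (Tri; tri<; tri≈; tri>)
open import Relation.Binary.PropositionalEquality
open import Relation.Nullary using (contradiction)

open import Defs

2*m≡m+m : ∀ m → 2 * m ≡ m + m
2*m≡m+m m = cong (m +_) (+-identityʳ m)

2*⌊n/2⌋≤n : ∀ n → 2 * ⌊ n /2⌋ ≤ n
2*⌊n/2⌋≤n n = begin
  2 * ⌊ n /2⌋         ≡⟨ 2*m≡m+m ⌊ n /2⌋ ⟩
  ⌊ n /2⌋ + ⌊ n /2⌋   ≤⟨ +-monoʳ-≤ ⌊ n /2⌋ (⌊n/2⌋≤⌈n/2⌉ n) ⟩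
  ⌊ n /2⌋ + ⌈ n /2⌉   ≡⟨ ⌊n/2⌋+⌈n/2⌉≡n n ⟩
  n                   ∎
  where open ≤-Reasoning

n≤2*⌈n/2⌉ : ∀ n → n ≤ 2 * ⌈ n /2⌉
n≤2*⌈n/2⌉ n = begin
  n                   ≡⟨ ⌊n/2⌋+⌈n/2⌉≡n n ⟨
  ⌊ n /2⌋ + ⌈ n /2⌉   ≤⟨ +-monoˡ-≤ ⌈ n /2⌉ (⌊n/2⌋≤⌈n/2⌉ n) ⟩
  ⌈ n /2⌉ + ⌈ n /2⌉   ≡⟨ 2*m≡m+m ⌈ n /2⌉ ⟨
  2 * ⌈ n /2⌉         ∎
  where open ≤-Reasoning

2*m<2*n∸1 : ∀ {m n} → m < n → 2 * m < 2 * n ∸ 1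
2*m<2*n∸1 {m} {n} m<n = m+n≤o⇒m≤o∸n (suc (2 * m)) (begin
  suc (2 * m) + 1   ≡⟨ +-comm (suc (2 * m)) 1 ⟩
  2 + 2 * m         ≡⟨ *-suc 2 m ⟨
  2 * suc m         ≤⟨ *-monoʳ-≤ 2 m<n ⟩
  2 * n             ∎)
  where open ≤-Reasoning

2*m∸1<2*n∸1 : ∀ {m n} → m < n → 2 * m ∸ 1 < 2 * n ∸ 1
2*m∸1<2*n∸1 {m} m<n = ≤-<-trans (m∸n≤m (2 * m) 1) (2*m<2*n∸1 m<n)

2*m∸1<2*n : ∀ {m n} → 0 < n → m ≤ n → 2 * m ∸ 1 < 2 * n
2*m∸1<2*n {n = suc n} _ m≤n = ≤-<-trans (∸-monoˡ-≤ 1 (*-monoʳ-≤ 2 m≤n)) (n<1+n _)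

∣m-n∣≡o⇒m≡n+o⊎n≡m+o : ∀ m n {o} → ∣ m - n ∣ ≡ o → m ≡ n + o ⊎ n ≡ m + o
∣m-n∣≡o⇒m≡n+o⊎n≡m+o zero    n       eq = inj₂ eq
∣m-n∣≡o⇒m≡n+o⊎n≡m+o (suc m) zero    eq = inj₁ eq
∣m-n∣≡o⇒m≡n+o⊎n≡m+o (suc m) (suc n) eq =
  Sum.map (cong suc) (cong suc) (∣m-n∣≡o⇒m≡n+o⊎n≡m+o m n eq)

o⊔⌈n/2⌉≤m⇒n≤2*m : ∀ {m n o} → o ⊔ ⌈ n /2⌉ ≤ m → n ≤ 2 * m
o⊔⌈n/2⌉≤m⇒n≤2*m {m} {n} {o} o⊔⌈n/2⌉≤m =
  ≤-trans (n≤2*⌈n/2⌉ n) (*-monoʳ-≤ 2 (≤-trans (m≤n⊔m o ⌈ n /2⌉) o⊔⌈n/2⌉≤m))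

m≤o⊓⌊n/2⌋⇒2*m≤n : ∀ {m n o} → m ≤ o ⊓ ⌊ n /2⌋ → 2 * m ≤ n
m≤o⊓⌊n/2⌋⇒2*m≤n {m} {n} {o} m≤o⊓⌊n/2⌋ =
  ≤-trans (*-monoʳ-≤ 2 (≤-trans m≤o⊓⌊n/2⌋ (m⊓n≤n o ⌊ n /2⌋))) (2*⌊n/2⌋≤n n)

2*m+2≤n⇒m<n∸m∸1 : ∀ {m n} → 2 * m + 2 ≤ n → m < n ∸ m ∸ 1
2*m+2≤n⇒m<n∸m∸1 {m} {n} 2m+2≤n =
  m+n≤o⇒m≤o∸n (suc m) (m+n≤o⇒m≤o∸n (suc m + 1) (begin
    suc m + 1 + m   ≡⟨ solve (m ∷ []) ⟩
    2 * m + 2       ≤⟨ 2m+2≤n ⟩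
    n               ∎))
  where open ≤-Reasoning

Fᶜ⇒C∸δ∸1≤b+a : ∀ {δ C a b c} → c ≤ δ → Fᶜ C a b c → C ∸ δ ∸ 1 ≤ b + a
Fᶜ⇒C∸δ∸1≤b+a {δ} {C} {a} {b} {c} c≤δ b+c+a+1≡C = begin
  C ∸ δ ∸ 1               ≤⟨ ∸-monoˡ-≤ 1 (∸-monoʳ-≤ C c≤δ) ⟩
  C ∸ c ∸ 1               ≡⟨ cong (λ n → n ∸ c ∸ 1) b+c+a+1≡C ⟨
  b + c + a + 1 ∸ c ∸ 1   ≡⟨ cong (λ n → n ∸ c ∸ 1) (solve (a ∷ b ∷ c ∷ [])) ⟩
  b + a + 1 + c ∸ c ∸ 1   ≡⟨ cong (_∸ 1) (m+n∸n≡m (b + a + 1) c) ⟩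
  b + a + 1 ∸ 1           ≡⟨ m+n∸n≡m (b + a) 1 ⟩
  b + a                   ∎
  where open ≤-Reasoning

module _ {δ M : ℕ} where

  t-below : ∀ {x} → x < M → t δ M x ≡ 2 * x ∸ 1
  t-below {x} x<M with x <ᵇ M | <⇒<ᵇ x<M
  ... | true | _ = refl

  t-above : ∀ {x} → M < x → t δ M x ≡ 2 * (δ ∸ x)
  t-above {x} M<x with x <ᵇ M in eq
  ... | false = refl
  ... | true  = contradiction (<ᵇ⇒< x M (subst T (sym eq) _)) (<⇒≯ M<x)

  t-<-below : ∀ {a b} → b < a → a < M → t δ M b < t δ M a
  t-<-below b<a a<M =
    subst₂ _<_ (sym (t-below (<-trans b<a a<M))) (sym (t-below a<M)) (2*m∸1<2*n∸1 b<a)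

  t-<-above : ∀ {a b} → M < a → a < b → b ≤ δ → t δ M b < t δ M a
  t-<-above M<a a<b b≤δ =
    subst₂ _<_ (sym (t-above (<-trans M<a a<b))) (sym (t-above M<a))
      (*-monoʳ-< 2 (∸-monoʳ-< a<b b≤δ))

  t-above<t-below : ∀ {a b} → M < b → 0 < a → a < M → δ < b + a → t δ M b < t δ M a
  t-above<t-below {a} {b} M<b 0<a a<M δ<b+a =
    subst₂ _<_ (sym (t-above M<b)) (sym (t-below a<M))
      (2*m<2*n∸1 (m<n+o⇒m∸n<o δ b {{>-nonZero 0<a}} δ<b+a))

  t-below<t-above : ∀ {a b} → 0 < b → b < M → M < a → b + a ≤ δ → t δ M b < t δ M a
  t-below<t-above {a} {b} 0<b b<M M<a b+a≤δ =
    subst₂ _<_ (sym (t-below b<M)) (sym (t-above M<a))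
      (2*m∸1<2*n (<-≤-trans 0<b b≤δ∸a) b≤δ∸a)
    where
    b≤δ∸a : b ≤ δ ∸ a
    b≤δ∸a = m+n≤o⇒m≤o∸n b b+a≤δ

  t-<-on-F⁺ : ∀ {a b c} → 0 < c → a < M → F⁺ a b c → t δ M b < t δ M a
  t-<-on-F⁺ {b = b} 0<c a<M b+c≡a = t-<-below (subst (b <_) b+c≡a (m<m+n b 0<c)) a<M

  t-<-on-Fᶜ : ∀ {C a b c} → b ≢ M → 0 < a → a < M → c ≤ δ →
              2 * M ≤ C ∸ δ ∸ 1 → 2 * δ + 2 ≤ C → Fᶜ C a b c → t δ M b < t δ M a
  t-<-on-Fᶜ {C} {a} {b} b≢M 0<a a<M c≤δ 2M≤C∸δ∸1 2δ+2≤C b+c+a+1≡C = by-position (<-cmp b M)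
    where
    C∸δ∸1≤b+a : C ∸ δ ∸ 1 ≤ b + a
    C∸δ∸1≤b+a = Fᶜ⇒C∸δ∸1≤b+a {a = a} {b} c≤δ b+c+a+1≡C

    by-position : Tri (b < M) (b ≡ M) (M < b) → t δ M b < t δ M a
    by-position (tri≈ _ b≡M _) = contradiction b≡M b≢M
    by-position (tri< b<M _ _) = contradiction (≤-trans 2M≤C∸δ∸1 C∸δ∸1≤b+a) (<⇒≱ b+a<2M)
      where
      b+a<2M : b + a < 2 * M
      b+a<2M = <-≤-trans (+-mono-< b<M a<M) (≤-reflexive (sym (2*m≡m+m M)))
    by-position (tri> _ _ M<b) =
      t-above<t-below M<b 0<a a<M (<-≤-trans (2*m+2≤n⇒m<n∸m∸1 2δ+2≤C) C∸δ∸1≤b+a)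

  t-<-on-F⁻ : ∀ {a b c} → b ≢ M → 0 < b → b ≤ δ → 0 < c → c ≤ δ → δ ≤ 2 * M → M < a →
              F⁻ a b c → t δ M b < t δ M a
  t-<-on-F⁻ {a} {b} {c} b≢M 0<b b≤δ 0<c c≤δ δ≤2M M<a ∣b-c∣≡a
    with ∣m-n∣≡o⇒m≡n+o⊎n≡m+o b c ∣b-c∣≡a
  ... | inj₁ b≡c+a = t-<-above M<a (subst (a <_) (sym b≡c+a) (m<n+m a 0<c)) b≤δ
  ... | inj₂ c≡b+a with <-cmp b M
  ...   | tri< b<M _ _ = t-below<t-above 0<b b<M M<a (subst (_≤ δ) c≡b+a c≤δ)
  ...   | tri≈ _ b≡M _ = contradiction b≡M b≢M
  ...   | tri> _ _ M<b = contradiction (≤-trans (subst (_≤ δ) c≡b+a c≤δ) δ≤2M) (<⇒≱ 2M<b+a)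
    where
    2M<b+a : 2 * M < b + a
    2M<b+a = ≤-<-trans (≤-reflexive (2*m≡m+m M)) (+-mono-< M<b M<a)

lemma5p8 : (δ K₁ K₂ C₀ C₁ M a b : ℕ) →
    Admissible δ K₁ K₂ C₀ C₁ →
    Magic δ K₁ K₂ (C₀ ⊓ C₁) M →
    InRange δ a → a ≢ M →
    InRange δ b → b ≢ M →
    Σ ℕ (λ c → InRange δ c × 𝔽 δ (C₀ ⊓ C₁) M a b c) →
    t δ M b < t δ M a
lemma5p8 δ K₁ K₂ C₀ C₁ M a b
  ((_ , _ , _ , _ , 2δ+2≤C₀ , _ , 2δ+2≤C₁ , _) , _) (_ , _ , K₁⊔⌈δ/2⌉≤M , M≤K₂⊓⌊S/2⌋)
  (0<a , _) _ (0<b , b≤δ) b≢M (c , (0<c , c≤δ) , _ , _ , family) with family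
... | inj₁ (a<M , inj₁ b+c≡a) = t-<-on-F⁺ 0<c a<M b+c≡a
... | inj₁ (a<M , inj₂ b+c+a+1≡C) =
  t-<-on-Fᶜ b≢M 0<a a<M c≤δ (m≤o⊓⌊n/2⌋⇒2*m≤n M≤K₂⊓⌊S/2⌋) (⊓-glb 2δ+2≤C₀ 2δ+2≤C₁) b+c+a+1≡C
... | inj₂ (M<a , ∣b-c∣≡a) =
  t-<-on-F⁻ b≢M 0<b b≤δ 0<c c≤δ (o⊔⌈n/2⌉≤m⇒n≤2*m K₁⊔⌈δ/2⌉≤M) M<a ∣b-c∣≡a
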